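{- Let $\varphi$ be an fPIL formula and $\zeta_1,\zeta_2$ fPCL formulas over $P$ and a De Morgan algebra $K$. Then $\varphi\otimes(\zeta_1\uplus\zeta_2)\equiv(\varphi\otimes\zeta_1)\uplus(\varphi\otimes\zeta_2)$.
   Context: A De Morgan algebra $(K,\vee,\wedge,0,1,\overline{\cdot})$ is a bounded distributive lattice with bottom $0$, top $1$ and a map $k\mapsto\overline k$ with $\overline{\overline k}=k$ and the De Morgan laws. $P$ is a set of ports; a $K$-fuzzy interaction is $\alpha:P\to K$ with $\alpha(p)\ne0$ for some $p$; $fC(P,K)$ is the set of nonempty (finite) sets of $K$-fuzzy interactions. fPIL formulas: $\varphi::=true\mid p\mid\,!\varphi\mid\varphi\sqcup\varphi$ with $\|true\|(\alpha)=1$, $\|p\|(\alpha)=\alpha(p)$, $\|!\varphi\|(\alpha)=\overline{\|\varphi\|(\alpha)}$, $\|\varphi_1\sqcup\varphi_2\|(\alpha)=\|\varphi_1\|(\alpha)\vee\|\varphi_2\|(\alpha)$. fPCL formulas: $\zeta::=\varphi\mid\neg\zeta\mid\zeta\oplus\zeta\mid\zeta\uplus\zeta$, $\zeta\otimes\zeta':=\neg(\neg\zeta\oplus\neg\zeta')$; for $\gamma\in fC(P,K)$: $\|\varphi\|(\gamma)=\bigwedge_{\alpha\in\gamma}\|\varphi\|(\alpha)$, $\|\neg\zeta\|(\gamma)=\overline{\|\zeta\|(\gamma)}$, $\|\zeta_1\oplus\zeta_2\|(\gamma)=\|\zeta_1\|(\gamma)\vee\|\zeta_2\|(\gamma)$,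 $\|\zeta_1\uplus\zeta_2\|(\gamma)=\bigvee_{\gamma_1,\gamma_2\in fC(P,K),\,\gamma_1\cup\gamma_2=\gamma}(\|\zeta_1\|(\gamma_1)\wedge\|\zeta_2\|(\gamma_2))$. $\zeta_1\equiv\zeta_2$ means $\|\zeta_1\|(\gamma)=\|\zeta_2\|(\gamma)$ for all $\gamma\in fC(P,K)$, for an arbitrary De Morgan algebra $K$. -}

module Defs where

open import Level using (Level; _⊔_) renaming (suc to lsuc)
open import Algebra.Core using (Op₁; Op₂)
open import Algebra.Lattice.Structures using (IsDistributiveLattice)
open import Relation.Binary.Core using (Rel)
open import Relation.Nullary using (¬_)
open import Data.Product using (Σ; _×_; _,_)
open import Data.List using (List; []; _∷_; concatMap; foldr; map)

record DeMorganAlgebra c ℓ : Set (lsuc (c ⊔ ℓ)) where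
  infixr 7 _∧_
  infixr 6 _∨_
  infix  4 _≈_
  field
    Carrier               : Set c
    _≈_                   : Rel Carrier ℓ
    _∨_                   : Op₂ Carrier
    _∧_                   : Op₂ Carrier
    ‾_                    : Op₁ Carrier
    𝟘                     : Carrier
    𝟙                     : Carrier
    isDistributiveLattice : IsDistributiveLattice _≈_ _∨_ _∧_
    ∨-identityʳ           : ∀ x → (x ∨ 𝟘) ≈ x
    ∧-identityʳ           : ∀ x → (x ∧ 𝟙) ≈ x
    ‾-cong                : ∀ {x y} → x ≈ y → (‾ x) ≈ (‾ y)
    ‾-involutive          : ∀ x → (‾ (‾ x)) ≈ x
    deMorgan-∨            : ∀ x y → (‾ (x ∨ y)) ≈ ((‾ x) ∧ (‾ y))
    deMorgan-∧            : ∀ x y → (‾ (x ∧ y)) ≈ ((‾ x) ∨ (‾ y))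

  open IsDistributiveLattice isDistributiveLattice public

data PIL {p : Level} (P : Set p) : Set p where
  true : PIL P
  port : P → PIL P
  !_   : PIL P → PIL P
  _⊔ᴵ_ : PIL P → PIL P → PIL P

data PCL {p : Level} (P : Set p) : Set p where
  pil  : PIL P → PCL P
  ¬ᶜ_  : PCL P → PCL P
  _⊕_  : PCL P → PCL P → PCL P
  _⊎ᶜ_ : PCL P → PCL P → PCL P

_⊗_ : ∀ {p} {P : Set p} → PCL P → PCL P → PCL P
ζ ⊗ ζ' = ¬ᶜ ((¬ᶜ ζ) ⊕ (¬ᶜ ζ'))

-- All ways of writing a list as a "union" of two sublists:
-- each element goes to the left part, the right part, or both.
splits : ∀ {a} {A : Set a} → List A → List (List A × List A)
splits [] = ([] , []) ∷ []
splits (x ∷ xs) = concatMap (λ { (l , r) → (x ∷ l , r) ∷ (l , x ∷ r) ∷ (x ∷ l , x ∷ r) ∷ [] }) (splits xs)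

module Semantics {c ℓ p : Level} (K : DeMorganAlgebra c ℓ) (P : Set p) where
  open DeMorganAlgebra K

  record Interaction : Set (c ⊔ ℓ ⊔ p) where
    constructor mkInteraction
    field
      α       : P → Carrier
      nonzero : Σ P (λ q → ¬ (α q ≈ 𝟘))
  open Interaction public

  -- a (finite) set of interactions, represented by a list enumerating it;
  -- fC(P,K) = the nonempty ones
  Config : Set (c ⊔ ℓ ⊔ p)
  Config = List Interaction

  ⋀ : List Carrier → Carrier
  ⋀ = foldr _∧_ 𝟙

  ⋁ : List Carrier → Carrier
  ⋁ = foldr _∨_ 𝟘

  ⟦_⟧ᴵ : PIL P → Interaction → Carrier
  ⟦ true ⟧ᴵ a = 𝟙
  ⟦ port q ⟧ᴵ a = α a q
  ⟦ ! φ ⟧ᴵ a = ‾ (⟦ φ ⟧ᴵ a)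
  ⟦ φ₁ ⊔ᴵ φ₂ ⟧ᴵ a = ⟦ φ₁ ⟧ᴵ a ∨ ⟦ φ₂ ⟧ᴵ a

  mutual
    ⟦_⟧ : PCL P → Config → Carrier
    ⟦ pil φ ⟧ γ = ⋀ (map ⟦ φ ⟧ᴵ γ)
    ⟦ ¬ᶜ ζ ⟧ γ = ‾ (⟦ ζ ⟧ γ)
    ⟦ ζ₁ ⊕ ζ₂ ⟧ γ = ⟦ ζ₁ ⟧ γ ∨ ⟦ ζ₂ ⟧ γ
    ⟦ ζ₁ ⊎ᶜ ζ₂ ⟧ γ = ⋁ (map (part ζ₁ ζ₂) (splits γ))

    -- contribution of a decomposition γ = γ₁ ∪ γ₂; only nonempty γ₁, γ₂ count
    part : PCL P → PCL P → List Interaction × List Interaction → Carrier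
    part ζ₁ ζ₂ ([] , _) = 𝟘
    part ζ₁ ζ₂ (_ ∷ _ , []) = 𝟘
    part ζ₁ ζ₂ (a ∷ γ₁ , b ∷ γ₂) = ⟦ ζ₁ ⟧ (a ∷ γ₁) ∧ ⟦ ζ₂ ⟧ (b ∷ γ₂)

  _≡ᶠ_ : PCL P → PCL P → Set (c ⊔ ℓ ⊔ p)
  ζ₁ ≡ᶠ ζ₂ = ∀ (a : Interaction) (γ : Config) → ⟦ ζ₁ ⟧ (a ∷ γ) ≈ ⟦ ζ₂ ⟧ (a ∷ γ)

-- Each pair (γ₁ , γ₂) enumerated by splits γ covers γ, so by idempotence of ∧
-- the meet ⟦ φ ⟧ γ equals ⟦ φ ⟧ γ₁ ∧ ⟦ φ ⟧ γ₂. As ⊗ is ∧ by the De Morgan laws,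
-- ⟦ φ ⟧ γ ∧ ⋁ (⟦ ζ₁ ⟧ γ₁ ∧ ⟦ ζ₂ ⟧ γ₂) distributes into the join, and each summand
-- regroups to (⟦ φ ⟧ γ₁ ∧ ⟦ ζ₁ ⟧ γ₁) ∧ (⟦ φ ⟧ γ₂ ∧ ⟦ ζ₂ ⟧ γ₂).
module Submission where

open import Defs
open import Level using (Level)
open import Algebra.Bundles using (CommutativeSemigroup)
open import Algebra.Lattice.Bundles using (Lattice)
import Algebra.Lattice.Properties.Lattice as LatticeProperties
import Algebra.Properties.CommutativeSemigroup as CommutativeSemigroupProperties
open import Data.Product using (_,_; proj₁; proj₂)
open import Data.List using (List; []; _∷_; map; foldr)
open import Data.List.Relation.Unary.All using (All; []; _∷_)
import Data.List.Relation.Unary.All as All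
open import Data.List.Relation.Unary.All.Properties using (concat⁺; map⁺)
import Relation.Binary.Reasoning.Setoid as SetoidReasoning
open import Relation.Binary.Bundles using (Setoid)

module DeMorganAlgebraProperties {c ℓ} (K : DeMorganAlgebra c ℓ) where
  open DeMorganAlgebra K

  setoid : Setoid c ℓ
  setoid = record { isEquivalence = isEquivalence }

  open SetoidReasoning setoid

  lattice : Lattice c ℓ
  lattice = record { isLattice = isLattice }

  open LatticeProperties lattice public
    using (∧-idem; ∧-isSemigroup)

  ∧-commutativeSemigroup : CommutativeSemigroup c ℓ
  ∧-commutativeSemigroup = record
    { isCommutativeSemigroup = record { isSemigroup = ∧-isSemigroup ; comm = ∧-comm } }

  open CommutativeSemigroupProperties ∧-commutativeSemigroup public
    using (interchange; x∙yz≈y∙xz)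

  ∧-zeroʳ : ∀ x → x ∧ 𝟘 ≈ 𝟘
  ∧-zeroʳ x = begin
    x ∧ 𝟘         ≈⟨ ∧-comm x 𝟘 ⟩
    𝟘 ∧ x         ≈⟨ ∧-congˡ (trans (∨-comm 𝟘 x) (∨-identityʳ x)) ⟨
    𝟘 ∧ (𝟘 ∨ x)   ≈⟨ ∧-absorbs-∨ 𝟘 x ⟩
    𝟘             ∎

  ‾[‾x∨‾y]≈x∧y : ∀ x y → ‾ ((‾ x) ∨ (‾ y)) ≈ x ∧ y
  ‾[‾x∨‾y]≈x∧y x y = trans (deMorgan-∨ (‾ x) (‾ y)) (∧-cong (‾-involutive x) (‾-involutive y))

  ∧-distribˡ-⋁ : ∀ {a} {A : Set a} x (f : A → Carrier) xs →
                 x ∧ foldr _∨_ 𝟘 (map f xs) ≈ foldr _∨_ 𝟘 (map (λ y → x ∧ f y) xs)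
  ∧-distribˡ-⋁ x f []       = ∧-zeroʳ x
  ∧-distribˡ-⋁ x f (y ∷ xs) = trans (∧-distribˡ-∨ x (f y) _) (∨-congˡ (∧-distribˡ-⋁ x f xs))

  ⋁-cong : ∀ {a} {A : Set a} {f g : A → Carrier} {xs} → All (λ y → f y ≈ g y) xs →
           foldr _∨_ 𝟘 (map f xs) ≈ foldr _∨_ 𝟘 (map g xs)
  ⋁-cong []         = refl
  ⋁-cong (eq ∷ eqs) = ∨-cong eq (⋁-cong eqs)

module SemanticsProperties {c ℓ p} (K : DeMorganAlgebra c ℓ) (P : Set p) where
  open DeMorganAlgebra K
  open DeMorganAlgebraProperties K
  open Semantics K P
  open SetoidReasoning setoid

  ⋀-splits : ∀ {a} {A : Set a} (f : A → Carrier) xs →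
             All (λ { (l , r) → ⋀ (map f xs) ≈ ⋀ (map f l) ∧ ⋀ (map f r) }) (splits xs)
  ⋀-splits f []               = sym (∧-identityʳ 𝟙) ∷ []
  ⋀-splits {A = A} f (x ∷ xs) = concat⁺ (map⁺ (All.map (λ { {l , r} → extend l r }) (⋀-splits f xs)))
    where
    ⋀f : List A → Carrier
    ⋀f ys = ⋀ (map f ys)
    v : Carrier
    v = f x
    extend : ∀ l r → ⋀f xs ≈ ⋀f l ∧ ⋀f r →
             All (λ { (l′ , r′) → ⋀f (x ∷ xs) ≈ ⋀f l′ ∧ ⋀f r′ })
                 ((x ∷ l , r) ∷ (l , x ∷ r) ∷ (x ∷ l , x ∷ r) ∷ [])
    extend l r eq =
        trans (∧-congˡ eq) (sym (∧-assoc v (⋀f l) (⋀f r)))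
      ∷ trans (∧-congˡ eq) (x∙yz≈y∙xz v (⋀f l) (⋀f r))
      ∷ (begin
          v ∧ ⋀f xs                   ≈⟨ ∧-cong (∧-idem v) (sym eq) ⟨
          (v ∧ v) ∧ (⋀f l ∧ ⋀f r)     ≈⟨ interchange v v (⋀f l) (⋀f r) ⟩
          (v ∧ ⋀f l) ∧ (v ∧ ⋀f r)     ∎)
      ∷ []

  ⟦⊗⟧ : ∀ ζ ζ′ γ → ⟦ ζ ⊗ ζ′ ⟧ γ ≈ ⟦ ζ ⟧ γ ∧ ⟦ ζ′ ⟧ γ
  ⟦⊗⟧ ζ ζ′ γ = ‾[‾x∨‾y]≈x∧y (⟦ ζ ⟧ γ) (⟦ ζ′ ⟧ γ)

  ∧-part≈part-⊗ : ∀ φ ζ₁ ζ₂ γ s → ⟦ pil φ ⟧ γ ≈ ⟦ pil φ ⟧ (proj₁ s) ∧ ⟦ pil φ ⟧ (proj₂ s) →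
                  ⟦ pil φ ⟧ γ ∧ part ζ₁ ζ₂ s ≈ part (pil φ ⊗ ζ₁) (pil φ ⊗ ζ₂) s
  ∧-part≈part-⊗ φ ζ₁ ζ₂ γ ([] , _)                 eq = ∧-zeroʳ _
  ∧-part≈part-⊗ φ ζ₁ ζ₂ γ (_ ∷ _ , [])             eq = ∧-zeroʳ _
  ∧-part≈part-⊗ φ ζ₁ ζ₂ γ (l@(_ ∷ _) , r@(_ ∷ _)) eq = begin
    ⟦ pil φ ⟧ γ ∧ (⟦ ζ₁ ⟧ l ∧ ⟦ ζ₂ ⟧ r)                   ≈⟨ ∧-congʳ eq ⟩
    (⟦ pil φ ⟧ l ∧ ⟦ pil φ ⟧ r) ∧ (⟦ ζ₁ ⟧ l ∧ ⟦ ζ₂ ⟧ r)   ≈⟨ interchange _ _ _ _ ⟩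
    (⟦ pil φ ⟧ l ∧ ⟦ ζ₁ ⟧ l) ∧ (⟦ pil φ ⟧ r ∧ ⟦ ζ₂ ⟧ r)   ≈⟨ ∧-cong (⟦⊗⟧ (pil φ) ζ₁ l) (⟦⊗⟧ (pil φ) ζ₂ r) ⟨
    ⟦ pil φ ⊗ ζ₁ ⟧ l ∧ ⟦ pil φ ⊗ ζ₂ ⟧ r                   ∎

mainTheorem12 : ∀ {c ℓ p : Level} (K : DeMorganAlgebra c ℓ) (P : Set p) (φ : PIL P) (ζ₁ ζ₂ : PCL P) → Semantics._≡ᶠ_ K P (pil φ ⊗ (ζ₁ ⊎ᶜ ζ₂)) ((pil φ ⊗ ζ₁) ⊎ᶜ (pil φ ⊗ ζ₂))
mainTheorem12 K P φ ζ₁ ζ₂ a γ = begin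
  ⟦ pil φ ⊗ (ζ₁ ⊎ᶜ ζ₂) ⟧ δ
    ≈⟨ ⟦⊗⟧ (pil φ) (ζ₁ ⊎ᶜ ζ₂) δ ⟩
  ⟦ pil φ ⟧ δ ∧ ⋁ (map (part ζ₁ ζ₂) (splits δ))
    ≈⟨ ∧-distribˡ-⋁ (⟦ pil φ ⟧ δ) (part ζ₁ ζ₂) (splits δ) ⟩
  ⋁ (map (λ s → ⟦ pil φ ⟧ δ ∧ part ζ₁ ζ₂ s) (splits δ))
    ≈⟨ ⋁-cong (All.map (λ {s} → ∧-part≈part-⊗ φ ζ₁ ζ₂ δ s) (⋀-splits ⟦ φ ⟧ᴵ δ)) ⟩
  ⟦ (pil φ ⊗ ζ₁) ⊎ᶜ (pil φ ⊗ ζ₂) ⟧ δ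
    ∎
  where
  open DeMorganAlgebra K
  open DeMorganAlgebraProperties K
  open SemanticsProperties K P
  open Semantics K P
  open SetoidReasoning setoid
  δ : Config
  δ = a ∷ γ
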